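{- Let $p$ be a prime with $p\equiv 1\pmod 4$, and let $1\le k\le n$ be integers. Let $\lambda$ be a partition of $2n$ into exactly $2k$ odd parts whose largest part is $p$, and let $c_i$ denote the number of parts of $\lambda$ equal to $i$ (so $c_i=0$ unless $i\in\{1,3,\dots,p\}$). Set $$\alpha=c_3+c_5+\cdots+c_{p-2},\qquad \beta=3c_3+5c_5+\cdots+(p-2)c_{p-2},$$ and $$N_\lambda=\frac{(2n)!}{\prod_{i} (i!)^{c_i}\, c_i!}.$$ Then $N_\lambda\equiv 0\pmod p$ unless both of the following hold: (i) $\alpha\le\beta<p$; (ii) $c_p=\left\lfloor\frac{2n-2k}{p-1}\right\rfloor$.
   Context: $N_\lambda$ is an integer: it counts set partitions of a $2n$-element set into blocks whose sizes are the parts of $\lambda$. -}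

module Defs where

open import Data.Nat using (ℕ; zero; suc; _+_; _*_; _∸_; _^_; _≤_; _<_; _≟_; NonZero; _!)
open import Data.Nat.Properties using (m*n≢0; m^n≢0)
open import Data.Nat.Properties using (_!≢0)
open import Data.Nat.DivMod using (_/_)
open import Data.List using (List; []; _∷_; length; filter; map; upTo)
open import Data.Nat.ListAction using (sum)

mult : List ℕ → ℕ → ℕ
mult λs i = length (filter (i ≟_) λs)

denom : (ℕ → ℕ) → List ℕ → ℕ
denom c [] = 1
denom c (i ∷ is) = ((i !) ^ c i) * (c i) ! * denom c is

denom≢0 : ∀ c is → NonZero (denom c is)
denom≢0 c [] = _
denom≢0 c (i ∷ is) =
  m*n≢0 (((i !) ^ c i) * (c i) !) (denom c is)
    {{m*n≢0 ((i !) ^ c i) ((c i) !) {{m^n≢0 (i !) (c i) {{i !≢0}}}} {{(c i) !≢0}}}}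
    {{denom≢0 c is}}

-- N_λ = (2n)! / ∏_i (i!)^{c_i} c_i!, the product over i = 0,1,…,2n
-- (every part of a partition of 2n lies in this range; other factors are 1)
Nλ : ℕ → List ℕ → ℕ
Nλ n λs = ((2 * n) ! / denom (mult λs) (upTo (suc (2 * n)))) {{denom≢0 (mult λs) (upTo (suc (2 * n)))}}

odds3toPm2 : ℕ → List ℕ
odds3toPm2 p = map (λ j → 2 * j + 3) (upTo ((p ∸ 3) / 2))

alpha : ℕ → List ℕ → ℕ
alpha p λs = sum (map (mult λs) (odds3toPm2 p))

beta : ℕ → List ℕ → ℕ
beta p λs = sum (map (λ i → i * mult λs i) (odds3toPm2 p))

-- floor division ⌊m / d⌋ (only used with d = p - 1 ≥ 4; value 0 for d = 0 is a dummy)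
⌊_/_⌋ : ℕ → ℕ → ℕ
⌊ m / zero ⌋ = 0
⌊ m / suc d ⌋ = m / suc d

-- Write D = ∏ᵢ (i!)^cᵢ cᵢ!, so that N_λ · D = (2n)!, and split D = Q · R with Q = ∏_{i ≠ p} (i!)^cᵢ,
-- which is prime to p since no part exceeds p, and R = (p!)^c_p ∏ᵢ cᵢ!. Sorting the parts into the
-- classes {p}, {1} and {3, …, p − 2} gives 2n = p·c_p + c₁ + β and R ∣ (p!)^c_p c_p! · c₁! · α!.
-- If p ≤ β then, as β ≥ 3α, also p · α! ∣ β!, so p · R ∣ (2n)! = N_λ · Q · R and hence p ∣ N_λ.
-- If β < p then, with 2k = c_p + c₁ + α, we get 2n − 2k = (p − 1)·c_p + (β − α) where
-- 0 ≤ β − α < p − 1, which is exactly (i) and (ii).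

{-# OPTIONS --safe #-}
module Submission where

open import Defs
open import Data.Nat using (ℕ; _+_; _*_; _∸_; _≤_; _<_; _≥_; _%_)
open import Data.Nat.Primality using (Prime)
open import Data.Nat.Divisibility using (_∣_)
open import Data.List using (List; length)
open import Data.Nat.ListAction using (sum)
open import Data.List.Membership.Propositional using (_∈_)
open import Data.List.Relation.Unary.All using (All)
open import Data.List.Relation.Unary.Linked using (Linked)
open import Data.Product using (_×_)
open import Relation.Binary.PropositionalEquality using (_≡_)
open import Relation.Nullary using (¬_)

open import Data.Bool using (true; false; if_then_else_)
open import Data.Empty using (⊥-elim)
open import Data.List using ([]; _∷_; map; upTo)
open import Data.List.Properties using (map-cong; map-cong-local; map-applyUpTo; map-id)
open import Data.List.Relation.Unary.All using ([]; _∷_; universal)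
import Data.List.Relation.Unary.All as All
open import Data.List.Relation.Unary.All.Properties using (map⁺)
open import Data.Nat
open import Data.Nat.Combinatorics using (k![n∸k]!∣n!)
open import Data.Nat.ListAction using (product)
open import Data.Nat.Properties
open import Data.Nat.Divisibility
  using (_∤_; divides; n∣m*n; m∣m*n; 1∣_; ∣1⇒≡1; ∣⇒≤; ∣-refl; ∣-trans; *-pres-∣; *-monoʳ-∣; *-cancelʳ-∣;
         m≤n⇒m!∣n!; module ∣-Reasoning)
open import Data.Nat.Primality using (euclidsLemma; ¬prime[1])
open import Algebra.Properties.CommutativeSemigroup +-commutativeSemigroup
  using () renaming (interchange to +-interchange)
open import Algebra.Properties.CommutativeSemigroup *-commutativeSemigroup
  using () renaming (interchange to *-interchange)
open import Data.Nat.Tactic.RingSolver using (solve-∀)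
open import Data.Sum using (_⊎_; inj₁; inj₂)
open import Data.Product using (Σ; _,_)
open import Data.Nat.DivMod
  using (_/_; m≡m%n+[m/n]*n; m*n/n≡m; m/n*n≡m; m<n⇒m/n≡0; m∣n⇒o%n%m≡o%m; +-distrib-/-∣ˡ)
open import Function using (_∘_; id)
open import Function.Definitions using (Injective)
open import Relation.Binary.Definitions using (Tri; tri<; tri≈; tri>)
open import Relation.Binary.PropositionalEquality
  using (_≢_; refl; sym; trans; cong; cong₂; subst; module ≡-Reasoning)
open import Relation.Nullary using (Dec; yes; no; does)
open import Relation.Nullary.Decidable using (dec-true; dec-false)

m!*n!∣[m+n]! : ∀ m n → m ! * n ! ∣ (m + n) !
m!*n!∣[m+n]! m n = subst (λ o → m ! * o ! ∣ (m + n) !) (m+n∸m≡n m n) (k![n∸k]!∣n! (m≤m+n m n))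

-- (m(n+1))! = (n+1)·m·(mn + m − 1)!, and (mn)!·(m − 1)! divides the last factorial.
[m!]^n*n!∣[m*n]! : ∀ m n .{{_ : NonZero m}} → (m !) ^ n * n ! ∣ (m * n) !
[m!]^n*n!∣[m*n]! m zero = 1∣ _
[m!]^n*n!∣[m*n]! m@(suc i) (suc n) = begin
  (m !) ^ suc n * suc n !                 ≡⟨ rearrange m (i !) ((m !) ^ n) (suc n) (n !) ⟩
  (suc n * m) * (i ! * ((m !) ^ n * n !)) ∣⟨ *-monoʳ-∣ (suc n * m) (*-monoʳ-∣ (i !) ([m!]^n*n!∣[m*n]! m n)) ⟩
  (suc n * m) * (i ! * (m * n) !)         ∣⟨ *-monoʳ-∣ (suc n * m) (m!*n!∣[m+n]! i (m * n)) ⟩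
  (suc n * m) * (i + m * n) !             ≡⟨ cong (_* (i + m * n) !) (expand i n) ⟩
  suc (i + m * n) !                       ≡⟨ cong _! (sym (*-suc m n)) ⟩
  (m * suc n) !                           ∎
  where
  open ∣-Reasoning
  rearrange : ∀ a f P s N → (a * f) * P * (s * N) ≡ (s * a) * (f * (P * N))
  rearrange = solve-∀
  expand : ∀ i n → suc n * suc i ≡ suc (i + suc i * n)
  expand = solve-∀

m*n!∣o! : ∀ {m n o} .{{_ : NonZero m}} → m ≤ o → n < m ⊎ n + m ≤ o → m * n ! ∣ o !
m*n!∣o! {suc m} m≤o (inj₁ n<m) = ∣-trans (*-monoʳ-∣ (suc m) (m≤n⇒m!∣n! (s≤s⁻¹ n<m))) (m≤n⇒m!∣n! m≤o)
m*n!∣o! {suc m} {n} {o} _ (inj₂ n+m≤o) = begin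
  suc m * n !     ∣⟨ *-pres-∣ (m∣m*n {suc m} (m !)) (∣-refl {n !}) ⟩
  suc m ! * n !   ∣⟨ m!*n!∣[m+n]! (suc m) n ⟩
  (suc m + n) !   ∣⟨ m≤n⇒m!∣n! (≤-trans (≤-reflexive (+-comm (suc m) n)) n+m≤o) ⟩
  o !             ∎
  where open ∣-Reasoning

p*[p!]^m*[m!*[o!*a!]]∣[m*p+o+b]! : ∀ {p m o a b} .{{_ : NonZero p}} → p ≤ b → a < p ⊎ a + p ≤ b →
  p * ((p !) ^ m * (m ! * (o ! * a !))) ∣ (m * p + o + b) !
p*[p!]^m*[m!*[o!*a!]]∣[m*p+o+b]! {p} {m} {o} {a} {b} p≤b a<p⊎a+p≤b = begin
  p * ((p !) ^ m * (m ! * (o ! * a !)))  ≡⟨ rearrange p ((p !) ^ m) (m !) (o !) (a !) ⟩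
  (p !) ^ m * m ! * o ! * (p * a !)
    ∣⟨ *-pres-∣ (*-pres-∣ ([m!]^n*n!∣[m*n]! p m) (∣-refl {o !})) (m*n!∣o! p≤b a<p⊎a+p≤b) ⟩
  (p * m) ! * o ! * b !                  ≡⟨ cong (λ x → x ! * o ! * b !) (*-comm p m) ⟩
  (m * p) ! * o ! * b !                  ∣⟨ *-pres-∣ (m!*n!∣[m+n]! (m * p) o) (∣-refl {b !}) ⟩
  (m * p + o) ! * b !                    ∣⟨ m!*n!∣[m+n]! (m * p + o) b ⟩
  (m * p + o + b) !                      ∎
  where
  open ∣-Reasoning
  rearrange : ∀ p P M O A → p * (P * (M * (O * A))) ≡ P * M * O * (p * A)
  rearrange = solve-∀

n!≡[u*n]!*[[v*n]!*[w*n]!] : ∀ u v w n → u + v + w ≡ 1 → n ! ≡ (u * n) ! * ((v * n) ! * (w * n) !)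
n!≡[u*n]!*[[v*n]!*[w*n]!] 1 0 0 n refl = sym (trans (*-identityʳ ((1 * n) !)) (cong _! (*-identityˡ n)))
n!≡[u*n]!*[[v*n]!*[w*n]!] 0 1 0 n refl =
  sym (trans (*-identityˡ ((1 * n) ! * 1)) (trans (*-identityʳ ((1 * n) !)) (cong _! (*-identityˡ n))))
n!≡[u*n]!*[[v*n]!*[w*n]!] 0 0 1 n refl =
  sym (trans (*-identityˡ (1 * (1 * n) !)) (trans (*-identityˡ ((1 * n) !)) (cong _! (*-identityˡ n))))

module _ {p : ℕ} (p-prime : Prime p) where

  prime∤1 : p ∤ 1
  prime∤1 p∣1 = ¬prime[1] (subst Prime (∣1⇒≡1 p∣1) p-prime)

  prime∤m! : ∀ {m} → m < p → p ∤ m !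
  prime∤m! {zero} _ = prime∤1
  prime∤m! {suc m} m<p p∣m! with euclidsLemma (suc m) (m !) p-prime p∣m!
  ... | inj₁ p∣1+m = <⇒≱ m<p (∣⇒≤ p∣1+m)
  ... | inj₂ p∣m! = prime∤m! (<-trans (n<1+n m) m<p) p∣m!

  prime∤m^n : ∀ {m} n → p ∤ m → p ∤ m ^ n
  prime∤m^n zero _ = prime∤1
  prime∤m^n {m} (suc n) p∤m p∣m^n with euclidsLemma m (m ^ n) p-prime p∣m^n
  ... | inj₁ p∣m = p∤m p∣m
  ... | inj₂ p∣m^n = prime∤m^n n p∤m p∣m^n

  prime∤product : ∀ {ms} → All (p ∤_) ms → p ∤ product ms
  prime∤product [] = prime∤1
  prime∤product {m ∷ ms} (p∤m ∷ p∤ms) p∣m*ms with euclidsLemma m (product ms) p-prime p∣m*ms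
  ... | inj₁ p∣m = p∤m p∣m
  ... | inj₂ p∣ms = prime∤product p∤ms p∣ms

  p*r∣n*[q*r]⇒p∣n : ∀ {n q r} .{{_ : NonZero r}} → p * r ∣ n * (q * r) → p ∤ q → p ∣ n
  p*r∣n*[q*r]⇒p∣n {n} {q} {r} p*r∣n*q*r p∤q
    with euclidsLemma n q p-prime (*-cancelʳ-∣ r (subst (p * r ∣_) (sym (*-assoc n q r)) p*r∣n*q*r))
  ... | inj₁ p∣n = p∣n
  ... | inj₂ p∣q = ⊥-elim (p∤q p∣q)

module _ (f : ℕ → ℕ) where

  sum-map-*ʳ : ∀ m xs → sum (map (λ x → f x * m) xs) ≡ sum (map f xs) * m
  sum-map-*ʳ m [] = refl
  sum-map-*ʳ m (x ∷ xs) = trans (cong (f x * m +_) (sum-map-*ʳ m xs)) (sym (*-distribʳ-+ m (f x) _))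

  product-map-^ : ∀ m xs → product (map (λ x → m ^ f x) xs) ≡ m ^ sum (map f xs)
  product-map-^ m [] = refl
  product-map-^ m (x ∷ xs) = trans (cong (m ^ f x *_) (product-map-^ m xs)) (sym (^-distribˡ-+-* m (f x) _))

  product-map-!∣sum-map-! : ∀ xs → product (map (λ x → f x !) xs) ∣ sum (map f xs) !
  product-map-!∣sum-map-! [] = ∣-refl
  product-map-!∣sum-map-! (x ∷ xs) =
    ∣-trans (*-monoʳ-∣ (f x !) (product-map-!∣sum-map-! xs)) (m!*n!∣[m+n]! (f x) (sum (map f xs)))

module _ (f g : ℕ → ℕ) where

  sum-map-+ : ∀ xs → sum (map (λ x → f x + g x) xs) ≡ sum (map f xs) + sum (map g xs)
  sum-map-+ [] = refl
  sum-map-+ (x ∷ xs) = trans (cong (f x + g x +_) (sum-map-+ xs)) (+-interchange (f x) (g x) _ _)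

  sum-map-mono : ∀ {xs} → All (λ x → f x ≤ g x) xs → sum (map f xs) ≤ sum (map g xs)
  sum-map-mono [] = z≤n
  sum-map-mono (fx≤gx ∷ fxs≤gxs) = +-mono-≤ fx≤gx (sum-map-mono fxs≤gxs)

  product-map-* : ∀ xs → product (map (λ x → f x * g x) xs) ≡ product (map f xs) * product (map g xs)
  product-map-* [] = refl
  product-map-* (x ∷ xs) = trans (cong (f x * g x *_) (product-map-* xs)) (*-interchange (f x) (g x) _ _)

  product-map-∣ : ∀ {xs} → All (λ x → f x ∣ g x) xs → product (map f xs) ∣ product (map g xs)
  product-map-∣ [] = ∣-refl
  product-map-∣ (fx∣gx ∷ fxs∣gxs) = *-pres-∣ fx∣gx (product-map-∣ fxs∣gxs)

product-map-!*!*!∣ : ∀ (f g h : ℕ → ℕ) xs →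
  product (map (λ x → f x ! * (g x ! * h x !)) xs) ∣ sum (map f xs) ! * (sum (map g xs) ! * sum (map h xs) !)
product-map-!*!*!∣ f g h xs = begin
  product (map (λ x → f x ! * (g x ! * h x !)) xs)
    ≡⟨ product-map-* (λ x → f x !) (λ x → g x ! * h x !) xs ⟩
  product (map (λ x → f x !) xs) * product (map (λ x → g x ! * h x !) xs)
    ≡⟨ cong (product (map (λ x → f x !) xs) *_) (product-map-* (λ x → g x !) (λ x → h x !) xs) ⟩
  product (map (λ x → f x !) xs) * (product (map (λ x → g x !) xs) * product (map (λ x → h x !) xs))
    ∣⟨ *-pres-∣ (product-map-!∣sum-map-! f xs)
                (*-pres-∣ (product-map-!∣sum-map-! g xs) (product-map-!∣sum-map-! h xs)) ⟩
  sum (map f xs) ! * (sum (map g xs) ! * sum (map h xs) !) ∎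
  where open ∣-Reasoning

All-≤-sum : ∀ xs → All (_≤ sum xs) xs
All-≤-sum [] = []
All-≤-sum (x ∷ xs) = m≤m+n x (sum xs) ∷ All.map (λ y≤sum → ≤-trans y≤sum (m≤n+m (sum xs) x)) (All-≤-sum xs)

length≡sum-map-1 : ∀ {A : Set} (xs : List A) → length xs ≡ sum (map (λ _ → 1) xs)
length≡sum-map-1 [] = refl
length≡sum-map-1 (_ ∷ xs) = cong suc (length≡sum-map-1 xs)

δ : ℕ → ℕ → ℕ
δ i j = if does (i ≟ j) then 1 else 0

δ-refl : ∀ i → δ i i ≡ 1
δ-refl i rewrite dec-true (i ≟ i) refl = refl

δ-≢ : ∀ {i j} → i ≢ j → δ i j ≡ 0
δ-≢ {i} {j} i≢j rewrite dec-false (i ≟ j) i≢j = refl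

δ-comm : ∀ i j → δ i j ≡ δ j i
δ-comm i j with i ≟ j
... | yes refl = refl
... | no i≢j = trans (δ-≢ i≢j) (sym (δ-≢ (i≢j ∘ sym)))

δ≤1 : ∀ i j → δ i j ≤ 1
δ≤1 i j with does (i ≟ j)
... | true = ≤-refl
... | false = z≤n

δ*-cong : ∀ (f : ℕ → ℕ) i j → δ i j * f i ≡ δ i j * f j
δ*-cong f i j with i ≟ j
... | yes refl = refl
... | no i≢j rewrite δ-≢ i≢j = refl

^δ*-cong : ∀ (f : ℕ → ℕ) i j n → f i ^ (δ i j * n) ≡ f j ^ (δ i j * n)
^δ*-cong f i j n with i ≟ j
... | yes refl = refl
... | no i≢j rewrite δ-≢ i≢j = refl

δ-injective : ∀ {g : ℕ → ℕ} → Injective _≡_ _≡_ g → ∀ i j → δ (g i) (g j) ≡ δ i j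
δ-injective {g} g-inj i j with i ≟ j
... | yes refl = trans (δ-refl (g i)) (sym (δ-refl i))
... | no i≢j = trans (δ-≢ (i≢j ∘ g-inj)) (sym (δ-≢ i≢j))

mult-∷ : ∀ x xs i → mult (x ∷ xs) i ≡ δ i x + mult xs i
mult-∷ x xs i with does (i ≟ x)
... | true = refl
... | false = refl

mult≡sum-δ : ∀ xs i → mult xs i ≡ sum (map (δ i) xs)
mult≡sum-δ [] i = refl
mult≡sum-δ (x ∷ xs) i = trans (mult-∷ x xs i) (cong (δ i x +_) (mult≡sum-δ xs i))

sum-map-δ* : ∀ (f : ℕ → ℕ) i xs → sum (map (λ x → δ i x * f x) xs) ≡ mult xs i * f i
sum-map-δ* f i xs = begin
  sum (map (λ x → δ i x * f x) xs) ≡⟨ cong sum (map-cong (λ x → sym (δ*-cong f i x)) xs) ⟩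
  sum (map (λ x → δ i x * f i) xs) ≡⟨ sum-map-*ʳ (δ i) (f i) xs ⟩
  sum (map (δ i) xs) * f i         ≡⟨ cong (_* f i) (mult≡sum-δ xs i) ⟨
  mult xs i * f i                  ∎
  where open ≡-Reasoning

-- Double counting of the pairs (j, y) ∈ xs × ys with j ≡ y, weighted by w j.
sum-map-*-mult : ∀ (w : ℕ → ℕ) xs ys →
  sum (map (λ j → w j * mult ys j) xs) ≡ sum (map (λ y → w y * mult xs y) ys)
sum-map-*-mult w xs [] = trans (sum-map-*ʳ w 0 xs) (*-zeroʳ (sum (map w xs)))
sum-map-*-mult w xs (y ∷ ys) = begin
  sum (map (λ j → w j * mult (y ∷ ys) j) xs)
    ≡⟨ cong sum (map-cong (λ j → trans (cong (w j *_) (mult-∷ y ys j)) (*-distribˡ-+ (w j) _ _)) xs) ⟩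
  sum (map (λ j → w j * δ j y + w j * mult ys j) xs)
    ≡⟨ sum-map-+ (λ j → w j * δ j y) (λ j → w j * mult ys j) xs ⟩
  sum (map (λ j → w j * δ j y) xs) + sum (map (λ j → w j * mult ys j) xs)
    ≡⟨ cong₂ _+_ (cong sum (map-cong (λ j → trans (*-comm (w j) _) (cong (_* w j) (δ-comm j y))) xs))
                 (sum-map-*-mult w xs ys) ⟩
  sum (map (λ j → δ y j * w j) xs) + sum (map (λ y → w y * mult xs y) ys)
    ≡⟨ cong (_+ _) (trans (sum-map-δ* w y xs) (*-comm (mult xs y) (w y))) ⟩
  w y * mult xs y + sum (map (λ y → w y * mult xs y) ys) ∎
  where open ≡-Reasoning

sum-map-*-mult-unique : ∀ (w : ℕ → ℕ) {xs ys} → All (λ y → mult xs y ≡ 1) ys →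
  sum (map (λ j → w j * mult ys j) xs) ≡ sum (map w ys)
sum-map-*-mult-unique w {xs} {ys} unique = trans (sum-map-*-mult w xs ys)
  (cong sum (map-cong-local (All.map (λ {y} mult≡1 → trans (cong (w y *_) mult≡1) (*-identityʳ (w y))) unique)))

mult-map : ∀ {g : ℕ → ℕ} → Injective _≡_ _≡_ g → ∀ xs x → mult (map g xs) (g x) ≡ mult xs x
mult-map g-inj [] x = refl
mult-map {g} g-inj (y ∷ xs) x = begin
  mult (map g (y ∷ xs)) (g x)         ≡⟨ mult-∷ (g y) (map g xs) (g x) ⟩
  δ (g x) (g y) + mult (map g xs) (g x) ≡⟨ cong₂ _+_ (δ-injective g-inj x y) (mult-map g-inj xs x) ⟩
  δ x y + mult xs x                   ≡⟨ mult-∷ y xs x ⟨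
  mult (y ∷ xs) x                     ∎
  where open ≡-Reasoning

mult-∉ : ∀ {x xs} → All (x ≢_) xs → mult xs x ≡ 0
mult-∉ [] = refl
mult-∉ {x} {y ∷ xs} (x≢y ∷ x∉xs) = trans (mult-∷ y xs x) (cong₂ _+_ (δ-≢ x≢y) (mult-∉ x∉xs))

mult-upTo-suc : ∀ n x → mult (upTo (suc n)) x ≡ δ x 0 + mult (map suc (upTo n)) x
mult-upTo-suc n x = trans (cong (λ l → mult l x) (cong (0 ∷_) (sym (map-applyUpTo id suc n)))) (mult-∷ 0 _ x)

mult-upTo-< : ∀ {n x} → x < n → mult (upTo n) x ≡ 1
mult-upTo-< {suc n} {zero} _ =
  trans (mult-upTo-suc n 0) (cong suc (mult-∉ (map⁺ (universal (λ _ ()) (upTo n)))))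
mult-upTo-< {suc n} {suc x} x<n =
  trans (mult-upTo-suc n (suc x)) (trans (mult-map suc-injective (upTo n) x) (mult-upTo-< (s≤s⁻¹ x<n)))

mult-upTo-≥ : ∀ {n x} → n ≤ x → mult (upTo n) x ≡ 0
mult-upTo-≥ {zero} _ = refl
mult-upTo-≥ {suc n} {suc x} n≤x =
  trans (mult-upTo-suc n (suc x)) (trans (mult-map suc-injective (upTo n) x) (mult-upTo-≥ (s≤s⁻¹ n≤x)))

middle : ℕ → ℕ → ℕ
middle p j = 1 ∸ (δ p j + δ 1 j)

δ+δ+middle≡1 : ∀ {p} → p ≢ 1 → ∀ j → δ p j + δ 1 j + middle p j ≡ 1
δ+δ+middle≡1 {p} p≢1 j = m+[n∸m]≡n (δ+δ≤1 (p ≟ j))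
  where
  δ+δ≤1 : Dec (p ≡ j) → δ p j + δ 1 j ≤ 1
  δ+δ≤1 (yes refl) rewrite δ-refl p | δ-≢ (p≢1 ∘ sym) = ≤-refl
  δ+δ≤1 (no p≢j) rewrite δ-≢ p≢j = δ≤1 1 j

middle-1 : ∀ p → middle p 1 ≡ 0
middle-1 p = m≤n⇒m∸n≡0 (m≤n+m 1 (δ p 1))

middle-p : ∀ p → middle p p ≡ 0
middle-p p rewrite δ-refl p = 0∸n≡0 (δ 1 p)

sum-by-class : ∀ {p} → p ≢ 1 → ∀ (f : ℕ → ℕ) xs →
  sum (map f xs) ≡ mult xs p * f p + mult xs 1 * f 1 + sum (map (λ x → middle p x * f x) xs)
sum-by-class {p} p≢1 f xs = begin
  sum (map f xs)
    ≡⟨ cong sum (map-cong classes xs) ⟩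
  sum (map (λ x → δ p x * f x + δ 1 x * f x + middle p x * f x) xs)
    ≡⟨ sum-map-+ (λ x → δ p x * f x + δ 1 x * f x) (λ x → middle p x * f x) xs ⟩
  sum (map (λ x → δ p x * f x + δ 1 x * f x) xs) + sum (map (λ x → middle p x * f x) xs)
    ≡⟨ cong (_+ sum (map (λ x → middle p x * f x) xs))
            (trans (sum-map-+ (λ x → δ p x * f x) (λ x → δ 1 x * f x) xs)
                   (cong₂ _+_ (sum-map-δ* f p xs) (sum-map-δ* f 1 xs))) ⟩
  mult xs p * f p + mult xs 1 * f 1 + sum (map (λ x → middle p x * f x) xs) ∎
  where
  open ≡-Reasoning
  classes : ∀ x → f x ≡ δ p x * f x + δ 1 x * f x + middle p x * f x
  classes x = begin
    f x                                          ≡⟨ *-identityˡ (f x) ⟨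
    1 * f x                                      ≡⟨ cong (_* f x) (δ+δ+middle≡1 p≢1 x) ⟨
    (δ p x + δ 1 x + middle p x) * f x           ≡⟨ *-distribʳ-+ (f x) (δ p x + δ 1 x) (middle p x) ⟩
    (δ p x + δ 1 x) * f x + middle p x * f x     ≡⟨ cong (_+ middle p x * f x) (*-distribʳ-+ (f x) (δ p x) (δ 1 x)) ⟩
    δ p x * f x + δ 1 x * f x + middle p x * f x ∎

denom≡product : ∀ c is → denom c is ≡ product (map (λ j → (j !) ^ c j * c j !) is)
denom≡product c [] = refl
denom≡product c (j ∷ is) = cong ((j !) ^ c j * c j ! *_) (denom≡product c is)

denom∣[sum-map]! : ∀ c → c 0 ≡ 0 → ∀ is → denom c is ∣ sum (map (λ j → j * c j) is) !
denom∣[sum-map]! c c0≡0 is = begin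
  denom c is                                  ≡⟨ denom≡product c is ⟩
  product (map (λ j → (j !) ^ c j * c j !) is) ∣⟨ product-map-∣ _ _ (universal factor∣ is) ⟩
  product (map (λ j → (j * c j) !) is)         ∣⟨ product-map-!∣sum-map-! (λ j → j * c j) is ⟩
  sum (map (λ j → j * c j) is) !              ∎
  where
  open ∣-Reasoning
  factor∣ : ∀ j → (j !) ^ c j * c j ! ∣ (j * c j) !
  factor∣ zero rewrite c0≡0 = ∣-refl
  factor∣ j@(suc _) = [m!]^n*n!∣[m*n]! j (c j)

module _ (p : ℕ) (c : ℕ → ℕ) where

  c↾p c↾≢p c↾1 c↾middle : ℕ → ℕ
  c↾p j = δ p j * c j
  c↾≢p j = (1 ∸ δ p j) * c j
  c↾1 j = δ 1 j * c j
  c↾middle j = middle p j * c j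

  primeFreePart : List ℕ → ℕ
  primeFreePart is = product (map (λ j → (j !) ^ c↾≢p j) is)

  cofactor : List ℕ → ℕ
  cofactor is = product (map (λ j → (j !) ^ c↾p j * c j !) is)

  denom≡primeFreePart*cofactor : ∀ is → denom c is ≡ primeFreePart is * cofactor is
  denom≡primeFreePart*cofactor is = begin
    denom c is                                                     ≡⟨ denom≡product c is ⟩
    product (map (λ j → (j !) ^ c j * c j !) is)                    ≡⟨ cong product (map-cong split is) ⟩
    product (map (λ j → (j !) ^ c↾≢p j * ((j !) ^ c↾p j * c j !)) is) ≡⟨ product-map-* _ _ is ⟩
    primeFreePart is * cofactor is                                 ∎
    where
    open ≡-Reasoning
    split : ∀ j → (j !) ^ c j * c j ! ≡ (j !) ^ c↾≢p j * ((j !) ^ c↾p j * c j !)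
    split j = begin
      (j !) ^ c j * c j !                         ≡⟨ cong (λ e → (j !) ^ e * c j !) c↾≢p+c↾p≡c ⟨
      (j !) ^ (c↾≢p j + c↾p j) * c j !            ≡⟨ cong (_* c j !) (^-distribˡ-+-* (j !) (c↾≢p j) (c↾p j)) ⟩
      (j !) ^ c↾≢p j * (j !) ^ c↾p j * c j !      ≡⟨ *-assoc ((j !) ^ c↾≢p j) ((j !) ^ c↾p j) (c j !) ⟩
      (j !) ^ c↾≢p j * ((j !) ^ c↾p j * c j !)    ∎
      where
      c↾≢p+c↾p≡c : c↾≢p j + c↾p j ≡ c j
      c↾≢p+c↾p≡c = trans (sym (*-distribʳ-+ (c j) (1 ∸ δ p j) (δ p j)))
                         (trans (cong (_* c j) (m∸n+n≡m (δ≤1 p j))) (*-identityˡ (c j)))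

  prime∤primeFreePart : Prime p → (∀ j → p < j → c j ≡ 0) → ∀ is → p ∤ primeFreePart is
  prime∤primeFreePart p-prime c-vanishes is = prime∤product p-prime (map⁺ (universal p∤factor is))
    where
    p∤factor : ∀ j → p ∤ (j !) ^ c↾≢p j
    p∤factor j with j <? p | p ≟ j
    ... | yes j<p | _ = prime∤m^n p-prime (c↾≢p j) (prime∤m! p-prime j<p)
    ... | no _ | yes refl rewrite δ-refl p = prime∤1 p-prime
    ... | no j≮p | no p≢j rewrite c-vanishes j (≤∧≢⇒< (≮⇒≥ j≮p) p≢j) | *-zeroʳ (1 ∸ δ p j) = prime∤1 p-prime

  cofactor∣ : p ≢ 1 → ∀ is → cofactor is ∣
    (p !) ^ sum (map c↾p is) * (sum (map c↾p is) ! * (sum (map c↾1 is) ! * sum (map c↾middle is) !))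
  cofactor∣ p≢1 is = begin
    cofactor is
      ≡⟨ cong product (map-cong split is) ⟩
    product (map (λ j → (p !) ^ c↾p j * classes! j) is)
      ≡⟨ product-map-* (λ j → (p !) ^ c↾p j) classes! is ⟩
    product (map (λ j → (p !) ^ c↾p j) is) * product (map classes! is)
      ≡⟨ cong (_* product (map classes! is)) (product-map-^ c↾p (p !) is) ⟩
    (p !) ^ sum (map c↾p is) * product (map classes! is)
      ∣⟨ *-monoʳ-∣ ((p !) ^ sum (map c↾p is)) (product-map-!*!*!∣ c↾p c↾1 c↾middle is) ⟩
    (p !) ^ sum (map c↾p is) * (sum (map c↾p is) ! * (sum (map c↾1 is) ! * sum (map c↾middle is) !)) ∎
    where
    open ∣-Reasoning
    classes! : ℕ → ℕ
    classes! j = c↾p j ! * (c↾1 j ! * c↾middle j !)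
    split : ∀ j → (j !) ^ c↾p j * c j ! ≡ (p !) ^ c↾p j * classes! j
    split j = cong₂ _*_ (sym (^δ*-cong _! p j (c j)))
      (n!≡[u*n]!*[[v*n]!*[w*n]!] (δ p j) (δ 1 j) (middle p j) (c j) (δ+δ+middle≡1 p≢1 j))

odd⇒≡1⊎≡2*y+3 : ∀ {x} → x % 2 ≡ 1 → x ≡ 1 ⊎ Σ ℕ (λ y → x ≡ 2 * y + 3)
odd⇒≡1⊎≡2*y+3 {x} x-odd with x / 2 | m≡m%n+[m/n]*n x 2
... | zero | x≡x%2 = inj₁ (trans x≡x%2 (cong (_+ 0) x-odd))
... | suc y | x≡x%2+[1+y]*2 = inj₂ (y , trans x≡x%2+[1+y]*2 (trans (cong (_+ suc y * 2) x-odd) (lemma y)))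
  where
  lemma : ∀ y → 1 + suc y * 2 ≡ 2 * y + 3
  lemma = solve-∀

1≢2*j+3 : ∀ j → 1 ≢ 2 * j + 3
1≢2*j+3 j 1≡2j+3 = 0≢1+n (suc-injective (trans 1≡2j+3 (+-comm (2 * j) 3)))

2*j+3-injective : Injective _≡_ _≡_ (λ j → 2 * j + 3)
2*j+3-injective {i} {j} 2i+3≡2j+3 = *-cancelˡ-≡ i j 2 (+-cancelʳ-≡ 3 (2 * i) (2 * j) 2i+3≡2j+3)

odds3toPm2≡ : ∀ L → odds3toPm2 (2 * L + 3) ≡ map (λ j → 2 * j + 3) (upTo L)
odds3toPm2≡ L = cong (λ m → map (λ j → 2 * j + 3) (upTo m))
  (trans (cong (_/ 2) (trans (m+n∸n≡m (2 * L) 3) (*-comm 2 L))) (m*n/n≡m L 2))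

middle≡mult-odds3toPm2 : ∀ L {x} → x % 2 ≡ 1 → x ≤ 2 * L + 3 →
  middle (2 * L + 3) x ≡ mult (odds3toPm2 (2 * L + 3)) x
middle≡mult-odds3toPm2 L {x} x-odd x≤p rewrite odds3toPm2≡ L with odd⇒≡1⊎≡2*y+3 {x} x-odd
... | inj₁ refl = trans (middle-1 (2 * L + 3)) (sym (mult-∉ (map⁺ (universal 1≢2*j+3 (upTo L)))))
... | inj₂ (y , refl) = trans (middle≡mult-upTo (<-cmp y L)) (sym (mult-map 2*j+3-injective (upTo L) y))
  where
  middle≡mult-upTo : Tri (y < L) (y ≡ L) (L < y) → middle (2 * L + 3) (2 * y + 3) ≡ mult (upTo L) y
  middle≡mult-upTo (tri< y<L _ _)
    rewrite δ-≢ {2 * L + 3} {2 * y + 3} (λ e → <⇒≢ y<L (sym (2*j+3-injective e))) | δ-≢ (1≢2*j+3 y)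
    = sym (mult-upTo-< y<L)
  middle≡mult-upTo (tri≈ _ refl _) = trans (middle-p (2 * L + 3)) (sym (mult-upTo-≥ {y} ≤-refl))
  middle≡mult-upTo (tri> _ _ L<y) = ⊥-elim (<⇒≱ (+-monoˡ-< 3 (*-monoʳ-< 2 L<y)) x≤p)

middle*3≤middle*x : ∀ p {x} → x % 2 ≡ 1 → middle p x * 3 ≤ middle p x * x
middle*3≤middle*x p {x} x-odd with odd⇒≡1⊎≡2*y+3 {x} x-odd
... | inj₁ refl rewrite middle-1 p = z≤n
... | inj₂ (y , refl) = *-monoʳ-≤ (middle p (2 * y + 3)) (m≤n+m 3 (2 * y))

⌊m*d+r/d⌋≡m : ∀ m {d r} → r < d → ⌊ m * d + r / d ⌋ ≡ m
⌊m*d+r/d⌋≡m m {d@(suc _)} {r} r<d = begin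
  (m * d + r) / d       ≡⟨ +-distrib-/-∣ˡ r (n∣m*n m) ⟩
  m * d / d + r / d     ≡⟨ cong₂ _+_ (m*n/n≡m m d) (m<n⇒m/n≡0 r<d) ⟩
  m + 0                 ≡⟨ +-identityʳ m ⟩
  m                     ∎
  where open ≡-Reasoning

[m*p+o+b]∸[m+o+a]≡m*[p∸1]+[b∸a] : ∀ m o {a b} p → a ≤ b → .{{_ : NonZero p}} →
  (m * p + o + b) ∸ (m + o + a) ≡ m * (p ∸ 1) + (b ∸ a)
[m*p+o+b]∸[m+o+a]≡m*[p∸1]+[b∸a] m o {a} {b} (suc d) a≤b = begin
  (m * suc d + o + b) ∸ (m + o + a)
    ≡⟨ cong (λ x → (m * suc d + o + x) ∸ (m + o + a)) (m∸n+n≡m a≤b) ⟨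
  (m * suc d + o + (b ∸ a + a)) ∸ (m + o + a)        ≡⟨ cong (_∸ (m + o + a)) (rearrange m d o (b ∸ a) a) ⟩
  (m * d + (b ∸ a) + (m + o + a)) ∸ (m + o + a)      ≡⟨ m+n∸n≡m (m * d + (b ∸ a)) (m + o + a) ⟩
  m * d + (b ∸ a)                                    ∎
  where
  open ≡-Reasoning
  rearrange : ∀ m d o r a → m * (1 + d) + o + (r + a) ≡ m * d + r + (m + o + a)
  rearrange = solve-∀

b∸a<p∸1 : ∀ {a b p} → b ≤ a * p → b < p → 1 < p → b ∸ a < p ∸ 1
b∸a<p∸1 {zero} {zero} {suc (suc _)} _ _ _ = z<s
b∸a<p∸1 {suc _} {zero} {suc (suc _)} _ _ _ = z<s
b∸a<p∸1 {_} {zero} {suc zero} _ _ (s≤s ())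
b∸a<p∸1 {suc a} {suc b} {suc _} _ (s≤s b<p) _ = ≤-<-trans (m∸n≤m b a) b<p

module Parts (L : ℕ) {λs : List ℕ}
  (odd-parts : All (λ i → i % 2 ≡ 1) λs) (parts≤p : All (_≤ 2 * L + 3) λs) where

  p : ℕ
  p = 2 * L + 3

  p≢1 : p ≢ 1
  p≢1 = 1≢2*j+3 L ∘ sym

  1<p : 1 < p
  1<p = ≤-trans (s≤s (s≤s z≤n)) (m≤n+m 3 (2 * L))

  instance
    p≢0 : NonZero p
    p≢0 = >-nonZero (<-trans z<s 1<p)

  middle≡mult-odds-parts : All (λ x → middle p x ≡ mult (odds3toPm2 p) x) λs
  middle≡mult-odds-parts =
    All.zipWith (λ (x-odd , x≤p) → middle≡mult-odds3toPm2 L x-odd x≤p) (odd-parts , parts≤p)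

  alpha≡sum-middle : alpha p λs ≡ sum (map (middle p) λs)
  alpha≡sum-middle = begin
    sum (map (mult λs) (odds3toPm2 p))
      ≡⟨ cong sum (map-cong (λ j → sym (*-identityˡ (mult λs j))) (odds3toPm2 p)) ⟩
    sum (map (λ j → 1 * mult λs j) (odds3toPm2 p))
      ≡⟨ sum-map-*-mult (λ _ → 1) (odds3toPm2 p) λs ⟩
    sum (map (λ x → 1 * mult (odds3toPm2 p) x) λs)
      ≡⟨ cong sum (map-cong-local (All.map (λ eq → trans (*-identityˡ _) (sym eq)) middle≡mult-odds-parts)) ⟩
    sum (map (middle p) λs) ∎
    where open ≡-Reasoning

  beta≡sum-middle* : beta p λs ≡ sum (map (λ x → middle p x * x) λs)
  beta≡sum-middle* = begin
    sum (map (λ j → j * mult λs j) (odds3toPm2 p))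
      ≡⟨ sum-map-*-mult id (odds3toPm2 p) λs ⟩
    sum (map (λ x → x * mult (odds3toPm2 p) x) λs)
      ≡⟨ cong sum (map-cong-local (All.map (λ {x} eq → trans (*-comm x _) (cong (_* x) (sym eq)))
                                           middle≡mult-odds-parts)) ⟩
    sum (map (λ x → middle p x * x) λs) ∎
    where open ≡-Reasoning

  sum≡mult*p+mult+beta : sum λs ≡ mult λs p * p + mult λs 1 + beta p λs
  sum≡mult*p+mult+beta = begin
    sum λs                                                    ≡⟨ cong sum (map-id λs) ⟨
    sum (map id λs)                                           ≡⟨ sum-by-class p≢1 id λs ⟩
    mult λs p * p + mult λs 1 * 1 + sum (map (λ x → middle p x * x) λs)
      ≡⟨ cong₂ (λ o b → mult λs p * p + o + b) (*-identityʳ (mult λs 1)) (sym beta≡sum-middle*) ⟩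
    mult λs p * p + mult λs 1 + beta p λs                     ∎
    where open ≡-Reasoning

  length≡mult+mult+alpha : length λs ≡ mult λs p + mult λs 1 + alpha p λs
  length≡mult+mult+alpha = begin
    length λs                                                 ≡⟨ length≡sum-map-1 λs ⟩
    sum (map (λ _ → 1) λs)                                    ≡⟨ sum-by-class p≢1 (λ _ → 1) λs ⟩
    mult λs p * 1 + mult λs 1 * 1 + sum (map (λ x → middle p x * 1) λs)
      ≡⟨ cong₂ (λ mo a → mo + a) (cong₂ _+_ (*-identityʳ (mult λs p)) (*-identityʳ (mult λs 1)))
               (trans (cong sum (map-cong (λ x → *-identityʳ (middle p x)) λs)) (sym alpha≡sum-middle)) ⟩
    mult λs p + mult λs 1 + alpha p λs                        ∎
    where open ≡-Reasoning

  alpha*3≤beta : alpha p λs * 3 ≤ beta p λs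
  alpha*3≤beta = begin
    alpha p λs * 3                             ≡⟨ cong (_* 3) alpha≡sum-middle ⟩
    sum (map (middle p) λs) * 3                ≡⟨ sum-map-*ʳ (middle p) 3 λs ⟨
    sum (map (λ x → middle p x * 3) λs)        ≤⟨ sum-map-mono _ _ (All.map (middle*3≤middle*x p) odd-parts) ⟩
    sum (map (λ x → middle p x * x) λs)        ≡⟨ beta≡sum-middle* ⟨
    beta p λs                                  ∎
    where open ≤-Reasoning

  beta≤alpha*p : beta p λs ≤ alpha p λs * p
  beta≤alpha*p = begin
    beta p λs                                  ≡⟨ beta≡sum-middle* ⟩
    sum (map (λ x → middle p x * x) λs)        ≤⟨ sum-map-mono _ _ (All.map (*-monoʳ-≤ (middle p _)) parts≤p) ⟩
    sum (map (λ x → middle p x * p) λs)        ≡⟨ sum-map-*ʳ (middle p) p λs ⟩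
    sum (map (middle p) λs) * p                ≡⟨ cong (_* p) alpha≡sum-middle ⟨
    alpha p λs * p                             ∎
    where open ≤-Reasoning

  alpha≤beta : alpha p λs ≤ beta p λs
  alpha≤beta = ≤-trans (m≤m*n (alpha p λs) 3) alpha*3≤beta

  beta<p⇒conditions : ∀ {n k} → sum λs ≡ 2 * n → length λs ≡ 2 * k → beta p λs < p →
    (alpha p λs ≤ beta p λs × beta p λs < p) × mult λs p ≡ ⌊ 2 * n ∸ 2 * k / p ∸ 1 ⌋
  beta<p⇒conditions {n} {k} sum≡2n length≡2k β<p = (alpha≤beta , β<p) , sym (begin
    ⌊ 2 * n ∸ 2 * k / p ∸ 1 ⌋
      ≡⟨ cong (λ x → ⌊ x / p ∸ 1 ⌋) (cong₂ _∸_ (trans (sym sum≡2n) sum≡mult*p+mult+beta)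
                                               (trans (sym length≡2k) length≡mult+mult+alpha)) ⟩
    ⌊ (mult λs p * p + mult λs 1 + beta p λs) ∸ (mult λs p + mult λs 1 + alpha p λs) / p ∸ 1 ⌋
      ≡⟨ cong (λ x → ⌊ x / p ∸ 1 ⌋) ([m*p+o+b]∸[m+o+a]≡m*[p∸1]+[b∸a] (mult λs p) (mult λs 1) p alpha≤beta) ⟩
    ⌊ mult λs p * (p ∸ 1) + (beta p λs ∸ alpha p λs) / p ∸ 1 ⌋
      ≡⟨ ⌊m*d+r/d⌋≡m (mult λs p) (b∸a<p∸1 {alpha p λs} beta≤alpha*p β<p 1<p) ⟩
    mult λs p ∎)
    where open ≡-Reasoning

  mult>p≡0 : ∀ j → p < j → mult λs j ≡ 0
  mult>p≡0 j p<j = mult-∉ (All.map (λ x≤p j≡x → <⇒≱ p<j (subst (_≤ p) (sym j≡x) x≤p)) parts≤p)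

  mult0≡0 : mult λs 0 ≡ 0
  mult0≡0 = mult-∉ (All.map (λ x-odd 0≡x → 0≢1+n (subst (λ y → y % 2 ≡ 1) (sym 0≡x) x-odd)) odd-parts)

  p≤beta⇒alpha<p⊎alpha+p≤beta : p ≤ beta p λs → alpha p λs < p ⊎ alpha p λs + p ≤ beta p λs
  p≤beta⇒alpha<p⊎alpha+p≤beta _ with alpha p λs + p ≤? beta p λs
  ... | yes α+p≤β = inj₂ α+p≤β
  ... | no α+p≰β = inj₁ (≤-<-trans (m≤m*n (alpha p λs) 2) (+-cancelˡ-< (alpha p λs) _ _ α+α*2<α+p))
    where
    α+α*2<α+p : alpha p λs + alpha p λs * 2 < alpha p λs + p
    α+α*2<α+p = ≤-<-trans (≤-trans (≤-reflexive (sym (*-suc (alpha p λs) 2))) alpha*3≤beta) (≰⇒> α+p≰β)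

  module _ {n : ℕ} (sum≡2n : sum λs ≡ 2 * n) where

    I : List ℕ
    I = upTo (suc (2 * n))

    sum-map-*-mult-I : ∀ w → sum (map (λ j → w j * mult λs j) I) ≡ sum (map w λs)
    sum-map-*-mult-I w = sum-map-*-mult-unique w
      (All.map (λ x≤sum → mult-upTo-< (s≤s (≤-trans x≤sum (≤-reflexive sum≡2n)))) (All-≤-sum λs))

    denom∣[2n]! : denom (mult λs) I ∣ (2 * n) !
    denom∣[2n]! = subst (λ s → denom (mult λs) I ∣ s !)
      (trans (sum-map-*-mult-I id) (trans (cong sum (map-id λs)) sum≡2n)) (denom∣[sum-map]! (mult λs) mult0≡0 I)

    p*cofactor∣[2n]! : p ≤ beta p λs → p * cofactor p (mult λs) I ∣ (2 * n) !
    p*cofactor∣[2n]! p≤β = begin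
      p * cofactor p (mult λs) I
        ∣⟨ *-monoʳ-∣ p (cofactor∣ p (mult λs) p≢1 I) ⟩
      F (sum (map (c↾p p (mult λs)) I)) (sum (map (c↾1 p (mult λs)) I)) (sum (map (c↾middle p (mult λs)) I))
        ≡⟨ cong₂ (λ m (o , a) → F m o a) (count p)
                 (cong₂ _,_ (count 1) (trans (sum-map-*-mult-I (middle p)) (sym alpha≡sum-middle))) ⟩
      F (mult λs p) (mult λs 1) (alpha p λs)
        ∣⟨ p*[p!]^m*[m!*[o!*a!]]∣[m*p+o+b]! {m = mult λs p} {mult λs 1} p≤β (p≤beta⇒alpha<p⊎alpha+p≤beta p≤β) ⟩
      (mult λs p * p + mult λs 1 + beta p λs) !
        ≡⟨ cong _! (trans (sym sum≡mult*p+mult+beta) sum≡2n) ⟩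
      (2 * n) ! ∎
      where
      open ∣-Reasoning
      F : ℕ → ℕ → ℕ → ℕ
      F m o a = p * ((p !) ^ m * (m ! * (o ! * a !)))
      count : ∀ i → sum (map (λ j → δ i j * mult λs j) I) ≡ mult λs i
      count i = trans (sum-map-*-mult-I (δ i)) (sym (mult≡sum-δ λs i))

    p≤beta⇒p∣Nλ : Prime p → p ≤ beta p λs → p ∣ Nλ n λs
    p≤beta⇒p∣Nλ p-prime p≤β = p*r∣n*[q*r]⇒p∣n p-prime {{cofactor≢0}}
      (subst (p * cofactor p (mult λs) I ∣_) (sym Nλ*denom≡[2n]!) (p*cofactor∣[2n]! p≤β))
      (prime∤primeFreePart p (mult λs) p-prime mult>p≡0 I)
      where
      Nλ*denom≡[2n]! : Nλ n λs * (primeFreePart p (mult λs) I * cofactor p (mult λs) I) ≡ (2 * n) !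
      Nλ*denom≡[2n]! = trans (cong (Nλ n λs *_) (sym (denom≡primeFreePart*cofactor p (mult λs) I)))
                             (m/n*n≡m {{denom≢0 (mult λs) I}} denom∣[2n]!)
      cofactor≢0 : NonZero (cofactor p (mult λs) I)
      cofactor≢0 = m*n≢0⇒n≢0 (primeFreePart p (mult λs) I)
        {{subst NonZero (denom≡primeFreePart*cofactor p (mult λs) I) (denom≢0 (mult λs) I)}}

lemma3p3 : (p n k : ℕ) → Prime p → p % 4 ≡ 1 → 1 ≤ k → k ≤ n →
    (λs : List ℕ) →
    Linked _≥_ λs →
    All (λ i → i % 2 ≡ 1) λs →
    sum λs ≡ 2 * n →
    length λs ≡ 2 * k →
    p ∈ λs →
    All (λ i → i ≤ p) λs →
    ¬ ((alpha p λs ≤ beta p λs × beta p λs < p)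
       × mult λs p ≡ ⌊ 2 * n ∸ 2 * k / p ∸ 1 ⌋) →
    p ∣ Nλ n λs
lemma3p3 p n k p-prime p%4≡1 _ _ λs _ odd-parts sum≡2n length≡2k _ parts≤p not-conditions
  with odd⇒≡1⊎≡2*y+3 {p} (trans (sym (m∣n⇒o%n%m≡o%m 2 4 p (divides 2 refl))) (cong (_% 2) p%4≡1))
... | inj₁ refl = ⊥-elim (¬prime[1] p-prime)
... | inj₂ (L , refl) =
  p≤beta⇒p∣Nλ {n} sum≡2n p-prime (≮⇒≥ (not-conditions ∘ beta<p⇒conditions {n} {k} sum≡2n length≡2k))
  where open Parts L odd-parts parts≤p
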